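{- For all $q>2$ and $n\ge 2$ there exists a negative orientable sequence of order $n$ over $\mathbb{Z}_q$ with period $(q-1)^n/2$ if $q$ and $n$ are both odd, and with period $((q-1)^n-k_{q,n,nq/2})/2$ if $q$ or $n$ is even, where $k_{q,n,w}$ is the number of $n$-tuples over $\{1,2,\ldots,q-1\}$ (zero-free $q$-ary $n$-tuples) whose entries, viewed as integers, sum to exactly $w$.
   Context: Sequences are periodic with entries in $\mathbb{Z}_q$. For $S=(s_i)$ write $\mathbf{s}_n(i)=(s_i,\ldots,s_{i+n-1})$; for an $n$-tuple $\mathbf{u}=(u_0,\ldots,u_{n-1})$ let $\mathbf{u}^R=(u_{n-1},\ldots,u_0)$ and $-\mathbf{u}=(-u_0,\ldots,-u_{n-1})$. A periodic sequence of period $m$ is an $n$-window sequence if $\mathbf{s}_n(i)=\mathbf{s}_n(j)$ implies $i\equiv j\pmod m$; it is a negative orientable sequence of order $n$ if also $\mathbf{s}_n(i)\neq-\mathbf{s}_n(j)^R$ for all $i,j$. -}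

module Defs where

open import Data.Nat using (ℕ; zero; suc; _+_; _*_; _∸_)
open import Data.Nat.DivMod using (_mod_)
open import Data.Fin using (Fin; toℕ)
open import Data.Vec using (Vec; []; _∷_; tabulate; reverse; map)
import Data.Vec as Vec
open import Data.List using (List; []; _∷_; length; filter; concatMap; upTo)
import Data.List as List
open import Data.Product using (∃; _×_)
open import Relation.Binary.PropositionalEquality using (_≡_; _≢_)
open import Data.Nat.Properties using (_≟_)

negℤ : {q : ℕ} → Fin q → Fin q
negℤ {suc q} x = (suc q ∸ toℕ x) mod (suc q)

window : {q : ℕ} (n : ℕ) → (ℕ → Fin q) → ℕ → Vec (Fin q) n
window n s i = tabulate (λ k → s (i + toℕ k))

negTuple : {q n : ℕ} → Vec (Fin q) n → Vec (Fin q) n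
negTuple = map negℤ

_≡_[mod_] : ℕ → ℕ → ℕ → Set
i ≡ j [mod m ] = ∃ λ a → ∃ λ b → i + a * m ≡ j + b * m

Periodic : {q : ℕ} → ℕ → (ℕ → Fin q) → Set
Periodic m s = ∀ i → s (i + m) ≡ s i

IsNWindowSeq : (q n m : ℕ) → (ℕ → Fin q) → Set
IsNWindowSeq q n m s =
  Periodic m s × (∀ i j → window n s i ≡ window n s j → i ≡ j [mod m ])

IsNegOrientable : (q n m : ℕ) → (ℕ → Fin q) → Set
IsNegOrientable q n m s =
  IsNWindowSeq q n m s ×
  (∀ i j → window n s i ≢ negTuple (reverse (window n s j)))

zeroFreeTuples : ℕ → (n : ℕ) → List (Vec ℕ n)
zeroFreeTuples q zero = [] ∷ []
zeroFreeTuples q (suc n) =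
  concatMap (λ a → List.map (suc a ∷_) (zeroFreeTuples q n)) (upTo (q ∸ 1))

k : ℕ → ℕ → ℕ → ℕ
k q n w = length (filter (λ v → Vec.sum v ≟ w) (zeroFreeTuples q n))

{-# OPTIONS --safe #-}
-- Call a zero-free word light if its weight (sum of entries) is below nq/2.
-- Negating a word over ℤ_q entrywise turns weight w into nq − w, so no light
-- word is the negated reverse of a light word: a periodic sequence whose
-- n-windows are the light words, each exactly once, is negative orientable.
-- Such a sequence exists by cycle joining: the light words contain 1ⁿ and are
-- closed under rotation and under lowering a letter, so every light word not yet
-- covered can be rotated and lowered until its (n−1)-prefix meets the current
-- cycle, and its whole rotation class can be spliced in there.  Its period is
-- the number of light words, which the weight-reversing involution
-- uᵢ ↦ q − uᵢ makes ((q−1)ⁿ − k_{q,n,nq/2})/2, the middle term being absent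
-- when nq is odd.
module Submission where

open import Defs
open import Data.Bool using (true; false; if_then_else_)
open import Data.Empty using (⊥-elim)
open import Data.Fin using (Fin; toℕ)
open import Data.Fin.Properties using (toℕ-fromℕ<; toℕ<n)
open import Data.List
  using (List; []; _∷_; _++_; _∷ʳ_; [_]; length; map; concatMap; take; drop; replicate; filter;
         upTo; applyUpTo; applyDownFrom; reverse)
open import Data.List.Properties
  using (length-++; length-++-sucʳ; length-applyUpTo; length-replicate; applyUpTo-∷ʳ; ∷ʳ-injective;
         ∷ʳ-injectiveˡ; ∷-injective; ++-assoc; ++-identityʳ; take++drop≡id; take-all; map-++; map-∘;
         map-cong; map-upTo; map-applyUpTo; reverse-applyUpTo; ≡-dec)
import Data.List.Membership.DecPropositional as DecMembership
open import Data.List.Membership.Propositional using (_∈_; _∉_)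
open import Data.List.Membership.Propositional.Properties
  using (∈-++⁺ˡ; ∈-++⁺ʳ; ∈-++⁻; ∈-concat⁺′; ∈-concat⁻′; ∈-map⁺; ∈-map⁻; ∈-applyUpTo⁺; ∈-applyUpTo⁻;
         ∈-filter⁺; ∈-filter⁻; ∈-upTo⁺; ∈-upTo⁻; ∈-∃++)
open import Data.List.Relation.Binary.Disjoint.Propositional using (Disjoint)
open import Data.List.Relation.Binary.Permutation.Propositional using (_↭_; ↭-sym; ↭⇒↭ₛ)
open import Data.List.Relation.Binary.Permutation.Propositional.Properties
  using (All-resp-↭; ∈-resp-↭; ↭-length; shifts; ↭-reverse)
  renaming (++-comm to ↭-++-comm; map⁺ to ↭-map⁺)
import Data.List.Relation.Binary.Permutation.Setoid.Properties as Permutationₛ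
open import Data.List.Relation.Binary.Subset.Propositional using (_⊆_)
open import Data.List.Relation.Unary.All as All using (All; []; _∷_)
import Data.List.Relation.Unary.All.Properties as All
open import Data.List.Relation.Unary.AllPairs using (AllPairs)
import Data.List.Relation.Unary.AllPairs.Properties as AllPairs
open import Data.List.Relation.Unary.Any using (here; there)
open import Data.List.Relation.Unary.Unique.Propositional using (Unique; []; _∷_)
import Data.List.Relation.Unary.Unique.Propositional.Properties as Unique
open import Data.Nat
  using (ℕ; zero; suc; _+_; _*_; _∸_; _^_; _≤_; _<_; z≤n; s≤s; _≤?_; _<?_; _≟_; NonZero; >-nonZero)
open import Data.Nat.DivMod
  using (_%_; _/_; _mod_; m≡m%n+[m/n]*n; m%n<n; m<n⇒m%n≡m; [m+n]%n≡m%n; %-distribˡ-+; m%n%n≡m%n;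
         m*n/n≡m; m*[n/m]≡n)
open import Data.Nat.Divisibility using (_∣_; divides; ∣-trans; n∣m*n; m∣m*n)
open import Data.Nat.ListAction using (sum)
open import Data.Nat.ListAction.Properties using (sum-++; sum-↭)
open import Data.Nat.Primality using (euclidsLemma; prime[2])
open import Data.Nat.Properties
open import Algebra.Properties.CommutativeSemigroup +-commutativeSemigroup using () renaming (interchange to +-interchange)
open import Data.Nat.Tactic.RingSolver using (solve-∀)
open import Data.Product using (∃; _×_; _,_; proj₁; proj₂)
open import Data.Sum using (_⊎_; inj₁; inj₂; [_,_]′)
open import Data.Vec as Vec using (Vec)
import Data.Vec.Properties as Vec
open import Function using (_∘_; flip)
open import Relation.Binary.Definitions using (tri<; tri≈; tri>)
open import Relation.Binary.PropositionalEquality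
  using (_≡_; _≢_; refl; sym; trans; cong; cong₂; subst; subst₂; setoid; module ≡-Reasoning)
open import Relation.Nullary using (¬_; Dec; yes; no; does)

open DecMembership (≡-dec _≟_) using (_∈?_)

module _ {A : Set} where

  applyUpTo-cong : ∀ {f g : ℕ → A} m → (∀ {k} → k < m → f k ≡ g k) → applyUpTo f m ≡ applyUpTo g m
  applyUpTo-cong zero    eq = refl
  applyUpTo-cong (suc m) eq = cong₂ _∷_ (eq (s≤s z≤n)) (applyUpTo-cong m (eq ∘ s≤s))

  applyUpTo-+ : ∀ (f : ℕ → A) a b → applyUpTo f (a + b) ≡ applyUpTo f a ++ applyUpTo (λ k → f (a + k)) b
  applyUpTo-+ f zero    b = refl
  applyUpTo-+ f (suc a) b = cong (f 0 ∷_) (applyUpTo-+ (f ∘ suc) a b)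

  Unique-applyUpTo⇒injective : ∀ (f : ℕ → A) m → Unique (applyUpTo f m) →
    ∀ {i j} → i < m → j < m → f i ≡ f j → i ≡ j
  Unique-applyUpTo⇒injective f (suc m) _ {zero}  {zero}  _ _ _ = refl
  Unique-applyUpTo⇒injective f (suc m) (f0∉ ∷ _) {zero} {suc j} _ (s≤s j<m) eq =
    ⊥-elim (All.lookup f0∉ (∈-applyUpTo⁺ (f ∘ suc) j<m) eq)
  Unique-applyUpTo⇒injective f (suc m) (f0∉ ∷ _) {suc i} {zero} (s≤s i<m) _ eq =
    ⊥-elim (All.lookup f0∉ (∈-applyUpTo⁺ (f ∘ suc) i<m) (sym eq))
  Unique-applyUpTo⇒injective f (suc m) (_ ∷ u) {suc i} {suc j} (s≤s i<m) (s≤s j<m) eq =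
    cong suc (Unique-applyUpTo⇒injective (f ∘ suc) m u i<m j<m eq)

  Unique-⊆⇒length≤ : ∀ {xs ys : List A} → Unique xs → xs ⊆ ys → length xs ≤ length ys
  Unique-⊆⇒length≤ {xs = []}     _          _   = z≤n
  Unique-⊆⇒length≤ {xs = x ∷ xs} (x∉ ∷ u) xs⊆ys with ys₁ , ys₂ , refl ← ∈-∃++ (xs⊆ys (here refl)) =
    subst (suc (length xs) ≤_) (sym (length-++-sucʳ ys₁ x ys₂))
      (s≤s (Unique-⊆⇒length≤ u (λ z∈xs → remove (xs⊆ys (there z∈xs)) (All.lookup x∉ z∈xs))))
    where
    remove : ∀ {z} → z ∈ ys₁ ++ x ∷ ys₂ → x ≢ z → z ∈ ys₁ ++ ys₂
    remove z∈ x≢z with ∈-++⁻ ys₁ z∈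
    ... | inj₁ p         = ∈-++⁺ˡ p
    ... | inj₂ (here eq) = ⊥-elim (x≢z (sym eq))
    ... | inj₂ (there p) = ∈-++⁺ʳ ys₁ p

  Unique-resp-↭ : ∀ {xs ys : List A} → xs ↭ ys → Unique xs → Unique ys
  Unique-resp-↭ xs↭ys = Permutationₛ.Unique-resp-↭ (setoid A) (↭⇒↭ₛ xs↭ys)

  ⊆-or-missing : ∀ (_≟ₐ_ : ∀ (a b : A) → Dec (a ≡ b)) xs ys → xs ⊆ ys ⊎ ∃ λ u → u ∈ xs × u ∉ ys
  ⊆-or-missing _≟ₐ_ []       ys = inj₁ λ ()
  ⊆-or-missing _≟ₐ_ (x ∷ xs) ys with DecMembership._∈?_ _≟ₐ_ x ys | ⊆-or-missing _≟ₐ_ xs ys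
  ... | no x∉ | _                      = inj₂ (x , here refl , x∉)
  ... | yes _ | inj₂ (u , u∈xs , u∉ys) = inj₂ (u , there u∈xs , u∉ys)
  ... | yes x∈ | inj₁ xs⊆ys = inj₁ λ { (here refl) → x∈ ; (there u∈) → xs⊆ys u∈ }

  take-++ˡ : ∀ {k} (xs ys : List A) → k ≤ length xs → take k (xs ++ ys) ≡ take k xs
  take-++ˡ {k = zero}  xs       ys _       = refl
  take-++ˡ {k = suc k} (x ∷ xs) ys (s≤s p) = cong (x ∷_) (take-++ˡ xs ys p)

  prefix-of-++ : ∀ {c R : List A} (xs ys : List A) → xs ++ ys ≡ c ++ R → length c ≤ length xs →
    ∃ λ R' → xs ≡ c ++ R'
  prefix-of-++ {[]}    xs       ys _  _       = xs , refl
  prefix-of-++ {_ ∷ c} (x ∷ xs) ys eq (s≤s p) with refl , eq' ← ∷-injective eq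
    with R' , refl ← prefix-of-++ {c} xs ys eq' p = R' , refl

  suffix-of-++ : ∀ {c R : List A} (xs ys : List A) → xs ++ ys ≡ R ++ c → length c ≤ length ys →
    ∃ λ R' → ys ≡ R' ++ c
  suffix-of-++ {R = R}     []       ys eq _ = R , eq
  suffix-of-++ {c} {[]}    (x ∷ xs) ys eq p = ⊥-elim (<⇒≱ (subst (length ys <_) (cong length eq) longer) p)
    where
    longer : length ys < length (x ∷ xs ++ ys)
    longer = s≤s (subst (length ys ≤_) (sym (length-++ xs)) (m≤n+m _ _))
  suffix-of-++ {R = _ ∷ R} (x ∷ xs) ys eq p = suffix-of-++ {R = R} xs ys (proj₂ (∷-injective eq)) p

  ∈⇒0<length : ∀ {x : A} {xs} → x ∈ xs → 0 < length xs
  ∈⇒0<length {xs = _ ∷ _} _ = s≤s z≤n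

  replicate-∷ʳ : ∀ m (a : A) → replicate (suc m) a ≡ replicate m a ∷ʳ a
  replicate-∷ʳ zero    a = refl
  replicate-∷ʳ (suc m) a = cong (a ∷_) (replicate-∷ʳ m a)

  length-∷ʳ : ∀ (v : List A) a → length (v ∷ʳ a) ≡ suc (length v)
  length-∷ʳ v a = trans (length-++ v) (+-comm (length v) 1)

at : List ℕ → ℕ → ℕ
at []       _       = 0
at (x ∷ xs) zero    = x
at (x ∷ xs) (suc i) = at xs i

at-applyUpTo : ∀ (f : ℕ → ℕ) {m k} → k < m → at (applyUpTo f m) k ≡ f k
at-applyUpTo f {suc m} {zero}  _         = refl
at-applyUpTo f {suc m} {suc k} (s≤s k<m) = at-applyUpTo (f ∘ suc) k<m

at-++ˡ : ∀ xs ys {i} → i < length xs → at (xs ++ ys) i ≡ at xs i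
at-++ˡ (x ∷ xs) ys {zero}  _       = refl
at-++ˡ (x ∷ xs) ys {suc i} (s≤s p) = at-++ˡ xs ys p

at-++ʳ : ∀ xs ys i → at (xs ++ ys) (length xs + i) ≡ at ys i
at-++ʳ []       ys i = refl
at-++ʳ (x ∷ xs) ys i = at-++ʳ xs ys i

All-at : ∀ {P : ℕ → Set} {xs} → All P xs → ∀ {i} → i < length xs → P (at xs i)
All-at (px ∷ _)   {zero}  _       = px
All-at (_  ∷ pxs) {suc i} (s≤s p) = All-at pxs p

applyUpTo-at : ∀ xs → applyUpTo (at xs) (length xs) ≡ xs
applyUpTo-at []       = refl
applyUpTo-at (x ∷ xs) = cong (x ∷_) (applyUpTo-at xs)

take≡applyUpTo-at : ∀ xs {k} → k ≤ length xs → take k xs ≡ applyUpTo (at xs) k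
take≡applyUpTo-at xs       {zero}  _       = refl
take≡applyUpTo-at (x ∷ xs) {suc k} (s≤s p) = cong (x ∷_) (take≡applyUpTo-at xs p)

sum-∷ʳ-< : ∀ v a → sum (v ∷ʳ a) < sum (v ∷ʳ suc a)
sum-∷ʳ-< v a = subst₂ _<_ (sym (sum-++ v [ a ])) (sym (sum-++ v [ suc a ])) (+-monoʳ-< (sum v) ≤-refl)

windows : ℕ → List ℕ → List (List ℕ)
windows n []       = []
windows n (x ∷ xs) with n ≤? length (x ∷ xs)
... | yes _ = take n (x ∷ xs) ∷ windows n xs
... | no  _ = []

windows-∷ : ∀ {n} x xs → n ≤ length (x ∷ xs) → windows n (x ∷ xs) ≡ take n (x ∷ xs) ∷ windows n xs
windows-∷ {n} x xs n≤ with n ≤? length (x ∷ xs)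
... | yes _ = refl
... | no n≰ = ⊥-elim (n≰ n≤)

windows-short : ∀ {n} xs → length xs < n → windows n xs ≡ []
windows-short         []       _ = refl
windows-short {n} (x ∷ xs) lt with n ≤? length (x ∷ xs)
... | yes n≤ = ⊥-elim (<⇒≱ lt n≤)
... | no  _  = refl

∈-windows⁻ : ∀ {n u} X → u ∈ windows n X → ∃ λ A → ∃ λ B → X ≡ A ++ u ++ B
∈-windows⁻ {n} (x ∷ xs) u∈ with n ≤? length (x ∷ xs)
∈-windows⁻ {n} (x ∷ xs) (here refl) | yes _ = [] , drop n (x ∷ xs) , sym (take++drop≡id n (x ∷ xs))
∈-windows⁻ {n} (x ∷ xs) (there u∈)  | yes _ with A , B , eq ← ∈-windows⁻ xs u∈ = x ∷ A , B , cong (x ∷_) eq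

windows≡applyUpTo : ∀ n' X →
  windows (suc n') X ≡ applyUpTo (λ j → applyUpTo (λ k → at X (j + k)) (suc n')) (length X ∸ n')
windows≡applyUpTo n' [] = cong (applyUpTo _) (sym (0∸n≡0 n'))
windows≡applyUpTo n' (x ∷ xs) with suc n' ≤? length (x ∷ xs)
... | yes (s≤s n'≤) = trans (cong₂ _∷_ (take≡applyUpTo-at (x ∷ xs) (s≤s n'≤)) (windows≡applyUpTo n' xs))
                            (cong (applyUpTo _) (sym (+-∸-assoc 1 n'≤)))
... | no  n≰       = cong (applyUpTo _) (sym (m≤n⇒m∸n≡0 (≤-pred (≰⇒> n≰))))

length-windows : ∀ n' X → length (windows (suc n') X) ≡ length X ∸ n'
length-windows n' X = trans (cong length (windows≡applyUpTo n' X)) (length-applyUpTo _ (length X ∸ n'))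

windows-++ : ∀ {n'} A v B → length v ≡ n' →
  windows (suc n') (A ++ v ++ B) ≡ windows (suc n') (A ++ v) ++ windows (suc n') (v ++ B)
windows-++ {n'} [] v B refl = cong (_++ windows (suc n') (v ++ B)) (sym (windows-short v ≤-refl))
windows-++ {n'} (a ∷ A) v B refl = begin
  windows (suc n') (a ∷ A ++ v ++ B)
    ≡⟨ windows-∷ a (A ++ v ++ B) (s≤s ∣v∣≤∣A++v++B∣) ⟩
  take (suc n') (a ∷ A ++ v ++ B) ∷ windows (suc n') (A ++ v ++ B)
    ≡⟨ cong₂ (λ w ws → (a ∷ w) ∷ ws) take-eq (windows-++ A v B refl) ⟩
  take (suc n') (a ∷ A ++ v) ∷ windows (suc n') (A ++ v) ++ windows (suc n') (v ++ B)
    ≡⟨ cong (_++ windows (suc n') (v ++ B)) (sym (windows-∷ a (A ++ v) (s≤s ∣v∣≤∣A++v∣))) ⟩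
  windows (suc n') (a ∷ A ++ v) ++ windows (suc n') (v ++ B) ∎
  where
  open ≡-Reasoning
  ∣v∣≤∣A++v∣ : length v ≤ length (A ++ v)
  ∣v∣≤∣A++v∣ = subst (length v ≤_) (sym (length-++ A)) (m≤n+m _ _)
  ∣v∣≤∣A++v++B∣ : length v ≤ length (A ++ v ++ B)
  ∣v∣≤∣A++v++B∣ = subst (λ z → length v ≤ length z) (++-assoc A v B)
    (≤-trans ∣v∣≤∣A++v∣ (subst (length (A ++ v) ≤_) (sym (length-++ (A ++ v))) (m≤m+n _ _)))
  take-eq : take (length v) (A ++ v ++ B) ≡ take (length v) (A ++ v)
  take-eq = trans (cong (take (length v)) (sym (++-assoc A v B))) (take-++ˡ (A ++ v) B ∣v∣≤∣A++v∣)

windows-insert : ∀ {n'} A v Q Q' B → length v ≡ n' → v ++ Q ≡ Q' ++ v →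
  windows (suc n') (A ++ (v ++ Q) ++ B) ≡ windows (suc n') (A ++ v) ++ windows (suc n') (v ++ Q) ++ windows (suc n') (v ++ B)
windows-insert {n'} A v Q Q' B ∣v∣≡n' v++Q≡Q'++v = begin
  windows (suc n') (A ++ (v ++ Q) ++ B)
    ≡⟨ cong (λ w → windows (suc n') (A ++ w)) (++-assoc v Q B) ⟩
  windows (suc n') (A ++ v ++ Q ++ B)
    ≡⟨ windows-++ A v (Q ++ B) ∣v∣≡n' ⟩
  windows (suc n') (A ++ v) ++ windows (suc n') (v ++ Q ++ B)
    ≡⟨ cong (λ w → windows (suc n') (A ++ v) ++ windows (suc n') w) v++Q++B≡Q'++v++B ⟩
  windows (suc n') (A ++ v) ++ windows (suc n') (Q' ++ v ++ B)
    ≡⟨ cong (windows (suc n') (A ++ v) ++_) (windows-++ Q' v B ∣v∣≡n') ⟩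
  windows (suc n') (A ++ v) ++ windows (suc n') (Q' ++ v) ++ windows (suc n') (v ++ B)
    ≡⟨ cong (λ w → windows (suc n') (A ++ v) ++ windows (suc n') w ++ windows (suc n') (v ++ B)) v++Q≡Q'++v ⟨
  windows (suc n') (A ++ v) ++ windows (suc n') (v ++ Q) ++ windows (suc n') (v ++ B) ∎
  where
  open ≡-Reasoning
  v++Q++B≡Q'++v++B : v ++ Q ++ B ≡ Q' ++ v ++ B
  v++Q++B≡Q'++v++B = trans (sym (++-assoc v Q B)) (trans (cong (_++ B) v++Q≡Q'++v) (++-assoc Q' v B))

module _ {A : Set} where

  rot : List A → List A
  rot []       = []
  rot (x ∷ xs) = xs ∷ʳ x

  rotate : ℕ → List A → List A
  rotate zero    u = u
  rotate (suc i) u = rotate i (rot u)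

  rot-injective : ∀ {u w} → rot u ≡ rot w → u ≡ w
  rot-injective {[]}     {[]}     _  = refl
  rot-injective {[]}     {_ ∷ []}     ()
  rot-injective {[]}     {_ ∷ _ ∷ _}  ()
  rot-injective {_ ∷ []}    {[]}      ()
  rot-injective {_ ∷ _ ∷ _} {[]}      ()
  rot-injective {x ∷ xs} {y ∷ ys} eq with refl , refl ← ∷ʳ-injective xs ys eq = refl

  rotate-injective : ∀ i {u w} → rotate i u ≡ rotate i w → u ≡ w
  rotate-injective zero    eq = eq
  rotate-injective (suc i) eq = rot-injective (rotate-injective i eq)

  rotate-+ : ∀ a b u → rotate (a + b) u ≡ rotate b (rotate a u)
  rotate-+ zero    b u = refl
  rotate-+ (suc a) b u = rotate-+ a b (rot u)

  rotate-suc : ∀ i u → rotate (suc i) u ≡ rot (rotate i u)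
  rotate-suc i u = trans (cong (λ j → rotate j u) (+-comm 1 i)) (rotate-+ i 1 u)

  rotate-++ : ∀ b ys → rotate (length b) (b ++ ys) ≡ ys ++ b
  rotate-++ []      ys = sym (++-identityʳ ys)
  rotate-++ (x ∷ b) ys = begin
    rotate (length b) ((b ++ ys) ++ [ x ]) ≡⟨ cong (rotate (length b)) (++-assoc b ys [ x ]) ⟩
    rotate (length b) (b ++ (ys ∷ʳ x))     ≡⟨ rotate-++ b (ys ∷ʳ x) ⟩
    (ys ∷ʳ x) ++ b                         ≡⟨ ++-assoc ys [ x ] b ⟩
    ys ++ x ∷ b                            ∎
    where open ≡-Reasoning

  rotate-length : ∀ u → rotate (length u) u ≡ u
  rotate-length u = trans (cong (λ w → rotate (length u) w) (sym (++-identityʳ u))) (rotate-++ u [])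

  rot-↭ : ∀ u → rot u ↭ u
  rot-↭ []       = _↭_.refl
  rot-↭ (x ∷ xs) = ↭-++-comm xs [ x ]

  RotationClosed : (List A → Set) → Set
  RotationClosed P = ∀ {u} → P u → P (rot u)

  module _ {P : List A → Set} (closed : RotationClosed P) where

    rotate-closed : ∀ i {u} → P u → P (rotate i u)
    rotate-closed zero    pu = pu
    rotate-closed (suc i) pu = rotate-closed i (closed pu)

    rotate-closed⁻ : ∀ {i u} → i ≤ length u → P (rotate i u) → P u
    rotate-closed⁻ {i} {u} i≤ p = subst P eq (rotate-closed (length u ∸ i) p)
      where
      eq : rotate (length u ∸ i) (rotate i u) ≡ u
      eq = trans (sym (rotate-+ i (length u ∸ i) u))
                 (trans (cong (λ j → rotate j u) (m+[n∸m]≡n i≤)) (rotate-length u))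

    swap-closed : ∀ b ys → P (b ++ ys) → P (ys ++ b)
    swap-closed b ys p = subst P (rotate-++ b ys) (rotate-closed (length b) p)

twice-+ : ∀ a b → 2 * a + 2 * b ≡ (a + b) + (a + b)
twice-+ = solve-∀

complement-< : ∀ {a b N} → a + b ≡ N → N < 2 * a → 2 * b < N
complement-< {a} {b} {N} a+b≡N N<2a = +-cancelˡ-< N (2 * b) N (begin-strict
  N + 2 * b          <⟨ +-monoˡ-< (2 * b) N<2a ⟩
  2 * a + 2 * b      ≡⟨ twice-+ a b ⟩
  (a + b) + (a + b)  ≡⟨ cong₂ _+_ a+b≡N a+b≡N ⟩
  N + N              ∎)
  where open ≤-Reasoning

complement-> : ∀ {a b N} → a + b ≡ N → 2 * b < N → N < 2 * a
complement-> {a} {b} {N} a+b≡N 2b<N = +-cancelʳ-< (2 * b) N (2 * a) (begin-strict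
  N + 2 * b          <⟨ +-monoʳ-< N 2b<N ⟩
  N + N              ≡⟨ cong₂ _+_ a+b≡N a+b≡N ⟨
  (a + b) + (a + b)  ≡⟨ twice-+ a b ⟨
  2 * a + 2 * b      ∎)
  where open ≤-Reasoning

%-equal⇒≡[mod] : ∀ {i j L} .{{_ : NonZero L}} → i % L ≡ j % L → i ≡ j [mod L ]
%-equal⇒≡[mod] {i} {j} {L} eq = j / L , i / L , (begin
  i + j / L * L                    ≡⟨ cong (_+ j / L * L) (m≡m%n+[m/n]*n i L) ⟩
  i % L + i / L * L + j / L * L    ≡⟨ swap-last (i % L) (i / L * L) (j / L * L) ⟩
  i % L + j / L * L + i / L * L    ≡⟨ cong (λ m → m + j / L * L + i / L * L) eq ⟩
  j % L + j / L * L + i / L * L    ≡⟨ cong (_+ i / L * L) (m≡m%n+[m/n]*n j L) ⟨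
  j + i / L * L                    ∎)
  where
  open ≡-Reasoning
  swap-last : ∀ a b c → a + b + c ≡ a + c + b
  swap-last = solve-∀

least-witness : ∀ {P : ℕ → Set} → (∀ e → Dec (P e)) → ∀ {m} → P m →
  ∃ λ d → d ≤ m × P d × (∀ {e} → e < d → ¬ P e)
least-witness P? {zero}  p = 0 , z≤n , p , λ ()
least-witness P? {suc m} p with P? 0
... | yes p0 = 0 , z≤n , p0 , λ ()
... | no ¬p0 with d , d≤m , pd , below ← least-witness (P? ∘ suc) {m} p =
  suc d , s≤s d≤m , pd , λ { {zero} _ → ¬p0 ; {suc e} (s≤s e<d) → below e<d }

-- Counting zero-free words by weight

χ : ∀ {P : Set} → Dec P → ℕ
χ d = if does d then 1 else 0

χ-yes : ∀ {P : Set} (d : Dec P) → P → χ d ≡ 1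
χ-yes (yes _) _  = refl
χ-yes (no ¬p) p = ⊥-elim (¬p p)

χ-no : ∀ {P : Set} (d : Dec P) → ¬ P → χ d ≡ 0
χ-no (yes p) ¬p = ⊥-elim (¬p p)
χ-no (no _)  _  = refl

χ-cong : ∀ {P Q : Set} (d : Dec P) (e : Dec Q) → (P → Q) → (Q → P) → χ d ≡ χ e
χ-cong d (yes q) _   Q→P = χ-yes d (Q→P q)
χ-cong d (no ¬q) P→Q _   = χ-no d (¬q ∘ P→Q)

module _ {A : Set} where

  length-filter≡sum-χ : ∀ {P : A → Set} (P? : ∀ x → Dec (P x)) xs →
    length (filter P? xs) ≡ sum (map (χ ∘ P?) xs)
  length-filter≡sum-χ P? []       = refl
  length-filter≡sum-χ P? (x ∷ xs) with does (P? x)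
  ... | true  = cong suc (length-filter≡sum-χ P? xs)
  ... | false = length-filter≡sum-χ P? xs

  sum-map-+ : ∀ (f g : A → ℕ) xs → sum (map (λ x → f x + g x) xs) ≡ sum (map f xs) + sum (map g xs)
  sum-map-+ f g []       = refl
  sum-map-+ f g (x ∷ xs) = trans (cong (f x + g x +_) (sum-map-+ f g xs)) (+-interchange (f x) (g x) _ _)

  sum-map-const : ∀ c (xs : List A) → sum (map (λ _ → c) xs) ≡ c * length xs
  sum-map-const c []       = sym (*-zeroʳ c)
  sum-map-const c (_ ∷ xs) = trans (cong (c +_) (sum-map-const c xs)) (sym (*-suc c (length xs)))

  sum-map-concatMap : ∀ {B : Set} (f : B → ℕ) (g : A → List B) xs →
    sum (map f (concatMap g xs)) ≡ sum (map (λ a → sum (map f (g a))) xs)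
  sum-map-concatMap f g []       = refl
  sum-map-concatMap f g (x ∷ xs) = begin
    sum (map f (g x ++ concatMap g xs))             ≡⟨ cong sum (map-++ f (g x) _) ⟩
    sum (map f (g x) ++ map f (concatMap g xs))     ≡⟨ sum-++ (map f (g x)) _ ⟩
    sum (map f (g x)) + sum (map f (concatMap g xs)) ≡⟨ cong (sum (map f (g x)) +_) (sum-map-concatMap f g xs) ⟩
    sum (map f (g x)) + sum (map (λ a → sum (map f (g a))) xs) ∎
    where open ≡-Reasoning

sum-map-concatMap-upTo : ∀ {B C : Set} (f : C → ℕ) (g : ℕ → B → C) (xs : List B) m →
  sum (map f (concatMap (λ a → map (g a) xs) (upTo m))) ≡ sum (applyUpTo (λ a → sum (map (f ∘ g a) xs)) m)
sum-map-concatMap-upTo f g xs m = begin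
  sum (map f (concatMap (λ a → map (g a) xs) (upTo m)))
    ≡⟨ sum-map-concatMap f (λ a → map (g a) xs) (upTo m) ⟩
  sum (map (λ a → sum (map f (map (g a) xs))) (upTo m))
    ≡⟨ cong sum (map-cong (λ a → cong sum (map-∘ xs)) (upTo m)) ⟨
  sum (map (λ a → sum (map (f ∘ g a) xs)) (upTo m))
    ≡⟨ cong sum (map-upTo _ m) ⟩
  sum (applyUpTo (λ a → sum (map (f ∘ g a) xs)) m) ∎
  where open ≡-Reasoning

applyDownFrom≡applyUpTo : ∀ {A : Set} (f : ℕ → A) m → applyDownFrom f m ≡ applyUpTo (λ a → f (m ∸ suc a)) m
applyDownFrom≡applyUpTo f zero    = refl
applyDownFrom≡applyUpTo f (suc m) = cong (f m ∷_) (applyDownFrom≡applyUpTo f m)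

sum-applyUpTo-reflect : ∀ (f : ℕ → ℕ) m → sum (applyUpTo f m) ≡ sum (applyUpTo (λ a → f (m ∸ suc a)) m)
sum-applyUpTo-reflect f m = begin
  sum (applyUpTo f m)                     ≡⟨ sum-↭ (↭-reverse (applyUpTo f m)) ⟨
  sum (reverse (applyUpTo f m))           ≡⟨ cong sum (reverse-applyUpTo f m) ⟩
  sum (applyDownFrom f m)                 ≡⟨ cong sum (applyDownFrom≡applyUpTo f m) ⟩
  sum (applyUpTo (λ a → f (m ∸ suc a)) m) ∎
  where open ≡-Reasoning

sum-applyUpTo-const : ∀ m c → sum (applyUpTo (λ _ → c) m) ≡ m * c
sum-applyUpTo-const zero    c = refl
sum-applyUpTo-const (suc m) c = cong (c +_) (sum-applyUpTo-const m c)

Letter : ℕ → ℕ → Set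
Letter q x = 0 < x × x < q

zeroFreeLists      : ℕ → ℕ → List (List ℕ)
zeroFreeLists-from : ℕ → ℕ → ℕ → List (List ℕ)

zeroFreeLists q zero    = [] ∷ []
zeroFreeLists q (suc n) = concatMap (zeroFreeLists-from q n) (upTo (q ∸ 1))

zeroFreeLists-from q n a = map (suc a ∷_) (zeroFreeLists q n)

sum-zeroFreeTuples≡sum-zeroFreeLists : ∀ q n (g : ℕ → ℕ) →
  sum (map (g ∘ Vec.sum) (zeroFreeTuples q n)) ≡ sum (map (g ∘ sum) (zeroFreeLists q n))
sum-zeroFreeTuples≡sum-zeroFreeLists q zero    g = refl
sum-zeroFreeTuples≡sum-zeroFreeLists q (suc n) g = begin
  sum (map (g ∘ Vec.sum) (zeroFreeTuples q (suc n)))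
    ≡⟨ sum-map-concatMap-upTo (g ∘ Vec.sum) (λ a → suc a Vec.∷_) (zeroFreeTuples q n) (q ∸ 1) ⟩
  sum (applyUpTo (λ a → sum (map (λ u → g (suc a + Vec.sum u)) (zeroFreeTuples q n))) (q ∸ 1))
    ≡⟨ cong sum (applyUpTo-cong (q ∸ 1) λ {a} _ →
         sum-zeroFreeTuples≡sum-zeroFreeLists q n (λ x → g (suc a + x))) ⟩
  sum (applyUpTo (λ a → sum (map (λ u → g (suc a + sum u)) (zeroFreeLists q n))) (q ∸ 1))
    ≡⟨ sum-map-concatMap-upTo (g ∘ sum) (λ a → suc a ∷_) (zeroFreeLists q n) (q ∸ 1) ⟨
  sum (map (g ∘ sum) (zeroFreeLists q (suc n))) ∎
  where open ≡-Reasoning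

length-zeroFreeLists : ∀ q n → length (zeroFreeLists q n) ≡ (q ∸ 1) ^ n
length-zeroFreeLists q zero    = refl
length-zeroFreeLists q (suc n) = begin
  length (zeroFreeLists q (suc n))
    ≡⟨ *-identityˡ _ ⟨
  1 * length (zeroFreeLists q (suc n))
    ≡⟨ sum-map-const 1 (zeroFreeLists q (suc n)) ⟨
  sum (map (λ _ → 1) (zeroFreeLists q (suc n)))
    ≡⟨ sum-map-concatMap-upTo (λ _ → 1) (λ a → suc a ∷_) (zeroFreeLists q n) (q ∸ 1) ⟩
  sum (applyUpTo (λ _ → sum (map (λ _ → 1) (zeroFreeLists q n))) (q ∸ 1))
    ≡⟨ cong (λ c → sum (applyUpTo (λ _ → c) (q ∸ 1)))
         (trans (sum-map-const 1 (zeroFreeLists q n)) (trans (*-identityˡ _) (length-zeroFreeLists q n))) ⟩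
  sum (applyUpTo (λ _ → (q ∸ 1) ^ n) (q ∸ 1))
    ≡⟨ sum-applyUpTo-const (q ∸ 1) ((q ∸ 1) ^ n) ⟩
  (q ∸ 1) ^ suc n ∎
  where open ≡-Reasoning

∈-zeroFreeLists⁻ : ∀ {q₁} n {u} → u ∈ zeroFreeLists (suc q₁) n → length u ≡ n × All (Letter (suc q₁)) u
∈-zeroFreeLists⁻ zero    (here refl) = refl , []
∈-zeroFreeLists⁻ {q₁} (suc n) u∈
  with _ , u∈xs , xs∈ ← ∈-concat⁻′ (map (zeroFreeLists-from (suc q₁) n) (upTo q₁)) u∈
  with a , a∈ , refl  ← ∈-map⁻ (zeroFreeLists-from (suc q₁) n) xs∈
  with _ , w∈ , refl  ← ∈-map⁻ (suc a ∷_) u∈xs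
  with ∣w∣≡n , letters ← ∈-zeroFreeLists⁻ n w∈ =
  cong suc ∣w∣≡n , (s≤s z≤n , s≤s (∈-upTo⁻ a∈)) ∷ letters

∈-zeroFreeLists⁺ : ∀ {q₁ u} → All (Letter (suc q₁)) u → u ∈ zeroFreeLists (suc q₁) (length u)
∈-zeroFreeLists⁺ []                         = here refl
∈-zeroFreeLists⁺ {u = suc a ∷ u} ((_ , s≤s a<q₁) ∷ letters) =
  ∈-concat⁺′ (∈-map⁺ (suc a ∷_) (∈-zeroFreeLists⁺ letters)) (∈-map⁺ _ (∈-upTo⁺ a<q₁))

zeroFreeLists-unique : ∀ q n → Unique (zeroFreeLists q n)
zeroFreeLists-unique q zero    = [] ∷ []
zeroFreeLists-unique q (suc n) = Unique.concat⁺
  (All.map⁺ (All.tabulate λ _ → Unique.map⁺ (proj₂ ∘ ∷-injective) (zeroFreeLists-unique q n)))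
  (subst (AllPairs Disjoint) (sym (map-upTo (zeroFreeLists-from q n) (q ∸ 1)))
    (AllPairs.applyUpTo⁺₁ (zeroFreeLists-from q n) (q ∸ 1)
      λ i<j _ (u∈i , u∈j) → <⇒≢ i<j (first-letter u∈i u∈j)))
  where
  first-letter : ∀ {u i j} → u ∈ zeroFreeLists-from q n i → u ∈ zeroFreeLists-from q n j → i ≡ j
  first-letter {i = i} {j} u∈i u∈j
    with _ , _ , refl ← ∈-map⁻ (suc i ∷_) u∈i
    with _ , _ , eq   ← ∈-map⁻ (suc j ∷_) u∈j =
    suc-injective (proj₁ (∷-injective eq))

-- Induction on n, reflecting the first letter a + 1 ↦ q − (a + 1).
sum-zeroFreeLists-complement : ∀ q₁ n (g h : ℕ → ℕ) → (∀ a b → a + b ≡ n * suc q₁ → g a ≡ h b) →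
  sum (map (g ∘ sum) (zeroFreeLists (suc q₁) n)) ≡ sum (map (h ∘ sum) (zeroFreeLists (suc q₁) n))
sum-zeroFreeLists-complement q₁ zero    g h g≡h = cong (_+ 0) (g≡h 0 0 refl)
sum-zeroFreeLists-complement q₁ (suc n) g h g≡h = begin
  sum (map (g ∘ sum) (Z (suc n)))
    ≡⟨ sum-map-concatMap-upTo (g ∘ sum) (λ a → suc a ∷_) (Z n) q₁ ⟩
  sum (applyUpTo (λ a → sum (map (λ u → g (suc a + sum u)) (Z n))) q₁)
    ≡⟨ cong sum (applyUpTo-cong q₁ λ a<q₁ → sum-zeroFreeLists-complement q₁ n _ _ (shift a<q₁)) ⟩
  sum (applyUpTo (λ a → sum (map (λ u → h (suc (q₁ ∸ suc a) + sum u)) (Z n))) q₁)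
    ≡⟨ sum-applyUpTo-reflect (λ a → sum (map (λ u → h (suc a + sum u)) (Z n))) q₁ ⟨
  sum (applyUpTo (λ a → sum (map (λ u → h (suc a + sum u)) (Z n))) q₁)
    ≡⟨ sum-map-concatMap-upTo (h ∘ sum) (λ a → suc a ∷_) (Z n) q₁ ⟨
  sum (map (h ∘ sum) (Z (suc n))) ∎
  where
  open ≡-Reasoning
  Z : ℕ → List (List ℕ)
  Z = zeroFreeLists (suc q₁)
  shift : ∀ {a} → a < q₁ → ∀ x y → x + y ≡ n * suc q₁ → g (suc a + x) ≡ h (suc (q₁ ∸ suc a) + y)
  shift {a} a<q₁ x y x+y≡ = g≡h _ _ (begin
    (suc a + x) + (suc (q₁ ∸ suc a) + y)  ≡⟨ +-interchange (suc a) x (suc (q₁ ∸ suc a)) y ⟩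
    (suc a + suc (q₁ ∸ suc a)) + (x + y)  ≡⟨ cong₂ _+_ (trans (+-suc (suc a) _) (cong suc (m+[n∸m]≡n a<q₁)))
                                                         x+y≡ ⟩
    suc q₁ + n * suc q₁                   ∎)

module HalfCount (q₁ n : ℕ) where

  q N : ℕ
  q = suc q₁
  N = n * q

  Z : List (List ℕ)
  Z = zeroFreeLists q n

  below? : ∀ u → Dec (2 * sum u < N)
  equal? : ∀ u → Dec (2 * sum u ≡ N)
  above? : ∀ u → Dec (N < 2 * sum u)
  below? u = 2 * sum u <? N
  equal? u = 2 * sum u ≟ N
  above? u = N <? 2 * sum u

  #below #equal : ℕ
  #below = length (filter below? Z)
  #equal = sum (map (χ ∘ equal?) Z)

  trichotomy : ∀ u → χ (below? u) + χ (equal? u) + χ (above? u) ≡ 1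
  trichotomy u with <-cmp (2 * sum u) N
  ... | tri< lt ¬eq ¬gt = cong₂ _+_ (cong₂ _+_ (χ-yes (below? u) lt) (χ-no (equal? u) ¬eq)) (χ-no (above? u) ¬gt)
  ... | tri≈ ¬lt eq ¬gt = cong₂ _+_ (cong₂ _+_ (χ-no (below? u) ¬lt) (χ-yes (equal? u) eq)) (χ-no (above? u) ¬gt)
  ... | tri> ¬lt ¬eq gt = cong₂ _+_ (cong₂ _+_ (χ-no (below? u) ¬lt) (χ-no (equal? u) ¬eq)) (χ-yes (above? u) gt)

  #above≡#below : sum (map (χ ∘ above?) Z) ≡ sum (map (χ ∘ below?) Z)
  #above≡#below = sum-zeroFreeLists-complement q₁ n (λ w → χ (N <? 2 * w)) (λ w → χ (2 * w <? N))
    λ a b a+b≡N → χ-cong (N <? 2 * a) (2 * b <? N) (complement-< {a} {b} a+b≡N) (complement-> {a} {b} a+b≡N)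

  twice-#below+#equal : #below * 2 + #equal ≡ q₁ ^ n
  twice-#below+#equal = begin
    #below * 2 + #equal                  ≡⟨ cong (λ b → b * 2 + #equal) (length-filter≡sum-χ below? Z) ⟩
    B * 2 + #equal                       ≡⟨ regroup B #equal ⟩
    B + #equal + B                       ≡⟨ cong (B + #equal +_) #above≡#below ⟨
    B + #equal + sum (map (χ ∘ above?) Z)
                                         ≡⟨ cong (_+ sum (map (χ ∘ above?) Z)) (sum-map-+ (χ ∘ below?) (χ ∘ equal?) Z) ⟨
    sum (map (λ u → χ (below? u) + χ (equal? u)) Z) + sum (map (χ ∘ above?) Z)
                                         ≡⟨ sum-map-+ (λ u → χ (below? u) + χ (equal? u)) (χ ∘ above?) Z ⟨
    sum (map (λ u → χ (below? u) + χ (equal? u) + χ (above? u)) Z)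
                                         ≡⟨ cong sum (map-cong trichotomy Z) ⟩
    sum (map (λ _ → 1) Z)                ≡⟨ sum-map-const 1 Z ⟩
    1 * length Z                         ≡⟨ *-identityˡ (length Z) ⟩
    length Z                             ≡⟨ length-zeroFreeLists q n ⟩
    q₁ ^ n                               ∎
    where
    open ≡-Reasoning
    B : ℕ
    B = sum (map (χ ∘ below?) Z)
    regroup : ∀ b e → b * 2 + e ≡ b + e + b
    regroup = solve-∀

  #below-odd : ¬ 2 ∣ N → #below ≡ q₁ ^ n / 2
  #below-odd 2∤N = begin
    #below                    ≡⟨ m*n/n≡m #below 2 ⟨
    #below * 2 / 2            ≡⟨ cong (_/ 2) (trans (cong (#below * 2 +_) #equal≡0) (+-identityʳ _)) ⟨
    (#below * 2 + #equal) / 2 ≡⟨ cong (_/ 2) twice-#below+#equal ⟩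
    q₁ ^ n / 2                ∎
    where
    open ≡-Reasoning
    #equal≡0 : #equal ≡ 0
    #equal≡0 = trans (cong sum (map-cong (λ u → χ-no (equal? u) (2∤N ∘ even u)) Z)) (sum-map-const 0 Z)
      where
      even : ∀ u → 2 * sum u ≡ N → 2 ∣ N
      even u eq = divides (sum u) (trans (sym eq) (*-comm 2 (sum u)))

  #below-even : 2 ∣ N → #below ≡ (q₁ ^ n ∸ k q n (N / 2)) / 2
  #below-even 2∣N = begin
    #below                             ≡⟨ m*n/n≡m #below 2 ⟨
    #below * 2 / 2                     ≡⟨ cong (_/ 2) (m+n∸n≡m (#below * 2) #equal) ⟨
    (#below * 2 + #equal ∸ #equal) / 2 ≡⟨ cong₂ (λ t e → (t ∸ e) / 2) twice-#below+#equal #equal≡k ⟩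
    (q₁ ^ n ∸ k q n (N / 2)) / 2       ∎
    where
    open ≡-Reasoning
    2[N/2]≡N : 2 * (N / 2) ≡ N
    2[N/2]≡N = m*[n/m]≡n 2∣N
    #equal≡k : #equal ≡ k q n (N / 2)
    #equal≡k = begin
      sum (map (χ ∘ equal?) Z)
        ≡⟨ cong sum (map-cong (λ u → χ-cong (equal? u) (sum u ≟ N / 2)
             (λ eq → *-cancelˡ-≡ (sum u) (N / 2) 2 (trans eq (sym 2[N/2]≡N)))
             (λ eq → trans (cong (2 *_) eq) 2[N/2]≡N)) Z) ⟩
      sum (map (λ u → χ (sum u ≟ N / 2)) Z)
        ≡⟨ sum-zeroFreeTuples≡sum-zeroFreeLists q n (λ w → χ (w ≟ N / 2)) ⟨
      sum (map (λ v → χ (Vec.sum v ≟ N / 2)) (zeroFreeTuples q n))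
        ≡⟨ length-filter≡sum-χ (λ v → Vec.sum v ≟ N / 2) (zeroFreeTuples q n) ⟨
      k q n (N / 2) ∎

-- Cycle joining

letter≥2 : ∀ {q} u → All (Letter q) u → u ≢ replicate (length u) 1 →
  ∃ λ a → ∃ λ z → ∃ λ b → u ≡ a ++ suc (suc z) ∷ b
letter≥2 []                _              u≢1ⁿ = ⊥-elim (u≢1ⁿ refl)
letter≥2 (zero ∷ u)        ((() , _) ∷ _) _
letter≥2 (suc zero ∷ u)    (_ ∷ letters)  u≢1ⁿ
  with a , z , b , refl ← letter≥2 u letters (u≢1ⁿ ∘ cong (1 ∷_)) = 1 ∷ a , z , b , refl
letter≥2 (suc (suc z) ∷ u) _              _    = [] , z , u , refl

-- The rotation class of r = v ∷ʳ x written out as one word of length d + n',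
-- d being the least rotation period of r.
module Unrolling (n' : ℕ) (v : List ℕ) (x : ℕ) (∣v∣≡n' : length v ≡ n') where

  n : ℕ
  n = suc n'

  r : List ℕ
  r = v ∷ʳ x

  ∣r∣≡n : length r ≡ n
  ∣r∣≡n = trans (length-∷ʳ v x) (cong suc ∣v∣≡n')

  letter : ℕ → ℕ
  letter t = at r (t % n)

  window-at : ℕ → List ℕ
  window-at i = applyUpTo (λ k → letter (i + k)) n

  window-at-0 : window-at 0 ≡ r
  window-at-0 = begin
    applyUpTo letter n            ≡⟨ applyUpTo-cong n (λ k<n → cong (at r) (m<n⇒m%n≡m k<n)) ⟩
    applyUpTo (at r) n            ≡⟨ cong (applyUpTo (at r)) ∣r∣≡n ⟨
    applyUpTo (at r) (length r)   ≡⟨ applyUpTo-at r ⟩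
    r                             ∎
    where open ≡-Reasoning

  window-at-suc : ∀ i → window-at (suc i) ≡ rot (window-at i)
  window-at-suc i = begin
    applyUpTo (λ k → letter (suc i + k)) n
      ≡⟨ applyUpTo-∷ʳ (λ k → letter (suc i + k)) n' ⟨
    applyUpTo (λ k → letter (suc i + k)) n' ∷ʳ letter (suc i + n')
      ≡⟨ cong₂ _∷ʳ_ (applyUpTo-cong n' (λ {k} _ → cong letter (sym (+-suc i k)))) wrap ⟩
    applyUpTo (λ k → letter (i + suc k)) n' ∷ʳ letter (i + 0) ∎
    where
    open ≡-Reasoning
    wrap : letter (suc i + n') ≡ letter (i + 0)
    wrap = begin
      at r ((suc i + n') % n) ≡⟨ cong (λ t → at r (t % n)) (sym (+-suc i n')) ⟩
      at r ((i + n) % n)      ≡⟨ cong (at r) ([m+n]%n≡m%n i n) ⟩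
      at r (i % n)            ≡⟨ cong (λ t → at r (t % n)) (+-identityʳ i) ⟨
      at r ((i + 0) % n)      ∎

  window-at≡rotate : ∀ i → window-at i ≡ rotate i r
  window-at≡rotate zero    = window-at-0
  window-at≡rotate (suc i) = trans (window-at-suc i) (trans (cong rot (window-at≡rotate i)) (sym (rotate-suc i r)))

  period : ∃ λ d' → d' ≤ n' × rotate (suc d') r ≡ r × (∀ {e} → e < d' → rotate (suc e) r ≢ r)
  period = least-witness (λ e → ≡-dec _≟_ (rotate (suc e) r) r)
    (subst (λ m → rotate m r ≡ r) ∣r∣≡n (rotate-length r))

  d : ℕ
  d = suc (proj₁ period)

  d≤n : d ≤ n
  d≤n = s≤s (proj₁ (proj₂ period))

  rotate-d : rotate d r ≡ r
  rotate-d = proj₁ (proj₂ (proj₂ period))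

  rotate-distinct : ∀ {i j} → i < j → j < d → rotate i r ≢ rotate j r
  rotate-distinct {i} {j} i<j j<d eq = proj₂ (proj₂ (proj₂ period)) e<d' (sym (rotate-injective i (begin
    rotate i r                     ≡⟨ eq ⟩
    rotate j r                     ≡⟨ cong (λ m → rotate m r) j≡ ⟩
    rotate (suc e + i) r           ≡⟨ rotate-+ (suc e) i r ⟩
    rotate i (rotate (suc e) r)    ∎)))
    where
    open ≡-Reasoning
    e : ℕ
    e = j ∸ suc i
    j≡ : j ≡ suc e + i
    j≡ = trans (sym (m∸n+n≡m i<j)) (+-suc e i)
    e<d' : e < proj₁ period
    e<d' = ≤-pred (≤-trans (s≤s (m≤m+n (suc e) i)) (subst (_≤ d) (cong suc j≡) j<d))

  word : List ℕ
  word = applyUpTo letter (d + n')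

  windows-word : windows n word ≡ applyUpTo window-at d
  windows-word = begin
    windows n word
      ≡⟨ windows≡applyUpTo n' word ⟩
    applyUpTo (λ j → applyUpTo (λ k → at word (j + k)) n) (length word ∸ n')
      ≡⟨ cong (applyUpTo _) (trans (cong (_∸ n') (length-applyUpTo letter (d + n'))) (m+n∸n≡m d n')) ⟩
    applyUpTo (λ j → applyUpTo (λ k → at word (j + k)) n) d
      ≡⟨ applyUpTo-cong d (λ j<d → applyUpTo-cong n (λ k<n →
           at-applyUpTo letter (+-mono-<-≤ j<d (≤-pred k<n)))) ⟩
    applyUpTo window-at d ∎
    where open ≡-Reasoning

  ∈-windows-word⁻ : ∀ {u} → u ∈ windows n word → ∃ λ i → i < d × u ≡ rotate i r
  ∈-windows-word⁻ u∈ with i , i<d , refl ← ∈-applyUpTo⁻ window-at (subst (_ ∈_) windows-word u∈) =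
    i , i<d , window-at≡rotate i

  rotate-∈-windows-word : ∀ {i} → i ≤ d → rotate i r ∈ windows n word
  rotate-∈-windows-word {i} i≤d with m≤n⇒m<n∨m≡n i≤d
  ... | inj₁ i<d  = subst₂ _∈_ (window-at≡rotate i) (sym windows-word) (∈-applyUpTo⁺ window-at i<d)
  ... | inj₂ refl = subst₂ _∈_ (trans window-at-0 (sym rotate-d)) (sym windows-word)
                              (∈-applyUpTo⁺ window-at (s≤s z≤n))

  windows-word-unique : Unique (windows n word)
  windows-word-unique = subst Unique (sym windows-word) (Unique.applyUpTo⁺₁ window-at d
    λ {i} {j} i<j j<d eq → rotate-distinct i<j j<d (trans (sym (window-at≡rotate i)) (trans eq (window-at≡rotate j))))

  length-windows-word : length (windows n word) ≡ d
  length-windows-word = trans (cong length windows-word) (length-applyUpTo window-at d)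

  prefix-of-window : ∀ i → rotate i r ≡ r → applyUpTo (λ k → letter (i + k)) n' ≡ v
  prefix-of-window i rotate-i≡r = ∷ʳ-injectiveˡ (applyUpTo (λ k → letter (i + k)) n') v
    (trans (applyUpTo-∷ʳ (λ k → letter (i + k)) n') (trans (window-at≡rotate i) rotate-i≡r))

  after-v before-v : List ℕ
  after-v  = applyUpTo (λ k → letter (n' + k)) d
  before-v = applyUpTo letter d

  word-starts : word ≡ v ++ after-v
  word-starts = trans (cong (applyUpTo letter) (+-comm d n'))
    (trans (applyUpTo-+ letter n' d) (cong (_++ after-v) (prefix-of-window 0 refl)))

  word-ends : word ≡ before-v ++ v
  word-ends = trans (applyUpTo-+ letter d n') (cong (before-v ++_) (prefix-of-window d rotate-d))

  word-letters : ∀ {P : ℕ → Set} → All P r → All P word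
  word-letters all-r = All.applyUpTo⁺₁ letter (d + n')
    (λ {t} _ → All-at all-r (subst (t % n <_) (sym ∣r∣≡n) (m%n<n t n)))

module CycleJoining
  (q n' : ℕ) (V : List (List ℕ))
  (V-unique   : Unique V)
  (V-length   : ∀ {u} → u ∈ V → length u ≡ suc n')
  (V-letters  : ∀ {u} → u ∈ V → All (Letter q) u)
  (V-rot      : RotationClosed (_∈ V))
  (V-decrease : ∀ {v x} → v ∷ʳ suc (suc x) ∈ V → v ∷ʳ suc x ∈ V)
  (V-ones     : replicate (suc n') 1 ∈ V)
  where

  n : ℕ
  n = suc n'

  -- X spells a cyclic word of length |X| ∸ n': its first and last n' letters
  -- agree, so its n-windows are exactly the windows of the cyclic word.
  record PartialCycle (X : List ℕ) : Set where
    field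
      letters    : All (Letter q) X
      prefix     : ∃ λ R → X ≡ replicate n' 1 ++ R
      suffix     : ∃ λ R → X ≡ R ++ replicate n' 1
      unique     : Unique (windows n X)
      sound      : windows n X ⊆ V
      rot-closed : RotationClosed (_∈ windows n X)
      ones∈      : replicate n 1 ∈ windows n X

  record Junction (X : List ℕ) : Set where
    field
      {v}    : List ℕ
      {x y}  : ℕ
      ∣v∣≡n' : length v ≡ n'
      new∈V  : v ∷ʳ x ∈ V
      new∉X  : v ∷ʳ x ∉ windows n X
      old∈X  : v ∷ʳ y ∈ windows n X

  initial : PartialCycle (replicate n 1)
  initial = record
    { letters    = V-letters V-ones
    ; prefix     = [ 1 ] , replicate-∷ʳ n' 1
    ; suffix     = [ 1 ] , refl
    ; unique     = subst Unique (sym windows-ones) ([] ∷ [])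
    ; sound      = λ u∈ → subst (_∈ V) (sym (single u∈)) V-ones
    ; rot-closed = λ u∈ → subst (_∈ windows n (replicate n 1))
                             (trans (replicate-∷ʳ n' 1) (cong rot (sym (single u∈)))) ones∈₀
    ; ones∈      = ones∈₀
    }
    where
    windows-ones : windows n (replicate n 1) ≡ [ replicate n 1 ]
    windows-ones = trans (windows-∷ 1 (replicate n' 1) (≤-reflexive (sym (length-replicate n))))
      (cong₂ _∷_ (take-all n (replicate n 1) (≤-reflexive (length-replicate n)))
                 (windows-short (replicate n' 1) (≤-reflexive (cong suc (length-replicate n')))))
    ones∈₀ : replicate n 1 ∈ windows n (replicate n 1)
    ones∈₀ = subst (replicate n 1 ∈_) (sym windows-ones) (here refl)
    single : ∀ {u} → u ∈ windows n (replicate n 1) → u ≡ replicate n 1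
    single {u} u∈ with here eq ← subst (u ∈_) windows-ones u∈ = eq

  -- The window v ∷ʳ y of X contains v, and the unrolled word of v ∷ʳ x begins
  -- and ends with v, so it can be inserted at that occurrence of v.
  splice : ∀ {X} → PartialCycle X → Junction X →
    ∃ λ X' → PartialCycle X' × length (windows n X) < length (windows n X')
  splice {X} C J = A ++ word ++ B , C' , longer
    where
    open PartialCycle C
    open Junction J
    open Unrolling n' v x ∣v∣≡n'
      using (r; ∣r∣≡n; d; d≤n; word; after-v; before-v; word-starts; word-ends; word-letters;
             windows-word-unique; length-windows-word; ∈-windows-word⁻; rotate-∈-windows-word)

    decomposition : ∃ λ A → ∃ λ B → X ≡ A ++ (v ∷ʳ y) ++ B
    decomposition = ∈-windows⁻ X old∈X
    A B : List ℕ
    A = proj₁ decomposition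
    B = y ∷ proj₁ (proj₂ decomposition)
    X' : List ℕ
    X' = A ++ word ++ B

    X≡AvB : X ≡ A ++ v ++ B
    X≡AvB = trans (proj₂ (proj₂ decomposition)) (cong (A ++_) (++-assoc v [ y ] _))

    windows-X : windows n X ≡ windows n (A ++ v) ++ windows n (v ++ B)
    windows-X = trans (cong (windows n) X≡AvB) (windows-++ A v B ∣v∣≡n')

    windows-X' : windows n X' ↭ windows n word ++ windows n X
    windows-X' = subst₂ _↭_
      (trans (sym (windows-insert A v after-v before-v B ∣v∣≡n' (trans (sym word-starts) word-ends)))
             (cong (λ w → windows n (A ++ w ++ B)) (sym word-starts)))
      (cong₂ _++_ (cong (windows n) (sym word-starts)) (sym windows-X))
      (shifts (windows n (A ++ v)) (windows n (v ++ after-v)))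

    from-word : windows n word ⊆ windows n X'
    from-word u∈ = ∈-resp-↭ (↭-sym windows-X') (∈-++⁺ˡ u∈)

    from-X : windows n X ⊆ windows n X'
    from-X u∈ = ∈-resp-↭ (↭-sym windows-X') (∈-++⁺ʳ (windows n word) u∈)

    from-X' : ∀ {u} → u ∈ windows n X' → u ∈ windows n word ⊎ u ∈ windows n X
    from-X' u∈ = ∈-++⁻ (windows n word) (∈-resp-↭ windows-X' u∈)

    i<d⇒i≤∣r∣ : ∀ {i} → i < d → i ≤ length r
    i<d⇒i≤∣r∣ i<d = ≤-trans (<⇒≤ i<d) (≤-trans d≤n (≤-reflexive (sym ∣r∣≡n)))

    disjoint : ∀ {u} → ¬ (u ∈ windows n word × u ∈ windows n X)
    disjoint (u∈word , u∈X) with i , i<d , refl ← ∈-windows-word⁻ u∈word =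
      new∉X (rotate-closed⁻ {P = _∈ windows n X} rot-closed (i<d⇒i≤∣r∣ i<d) u∈X)

    word-sound : windows n word ⊆ V
    word-sound u∈word with i , _ , refl ← ∈-windows-word⁻ u∈word = rotate-closed {P = _∈ V} V-rot i new∈V

    word-rot-closed : ∀ {u} → u ∈ windows n word → rot u ∈ windows n word
    word-rot-closed u∈word with i , i<d , refl ← ∈-windows-word⁻ u∈word =
      subst (_∈ windows n word) (rotate-suc i r) (rotate-∈-windows-word i<d)

    ∣ones∣≤∣v∣ : length (replicate n' 1) ≤ length v
    ∣ones∣≤∣v∣ = ≤-reflexive (trans (length-replicate n') (sym ∣v∣≡n'))

    X≡[Av]B : X ≡ (A ++ v) ++ B
    X≡[Av]B = trans X≡AvB (sym (++-assoc A v B))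

    ∣ones∣≤∣Av∣ : length (replicate n' 1) ≤ length (A ++ v)
    ∣ones∣≤∣Av∣ = ≤-trans ∣ones∣≤∣v∣ (subst (length v ≤_) (sym (length-++ A)) (m≤n+m _ _))

    ∣ones∣≤∣vB∣ : length (replicate n' 1) ≤ length (v ++ B)
    ∣ones∣≤∣vB∣ = ≤-trans ∣ones∣≤∣v∣ (subst (length v ≤_) (sym (length-++ v)) (m≤m+n _ _))

    letters' : All (Letter q) X'
    letters' = All.++⁺ (proj₁ A-v++B) (All.++⁺ (word-letters (V-letters new∈V)) (All.++⁻ʳ v (proj₂ A-v++B)))
      where
      A-v++B : All (Letter q) A × All (Letter q) (v ++ B)
      A-v++B = All.++⁻ A (subst (All (Letter q)) X≡AvB letters)

    prefix' : ∃ λ R → X' ≡ replicate n' 1 ++ R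
    prefix' with R , Av≡ ← prefix-of-++ (A ++ v) B (trans (sym X≡[Av]B) (proj₂ prefix)) ∣ones∣≤∣Av∣ =
      R ++ after-v ++ B , (begin
        A ++ word ++ B                   ≡⟨ cong (λ w → A ++ w ++ B) word-starts ⟩
        A ++ (v ++ after-v) ++ B         ≡⟨ cong (A ++_) (++-assoc v after-v B) ⟩
        A ++ v ++ after-v ++ B           ≡⟨ ++-assoc A v _ ⟨
        (A ++ v) ++ after-v ++ B         ≡⟨ cong (_++ after-v ++ B) Av≡ ⟩
        (replicate n' 1 ++ R) ++ after-v ++ B ≡⟨ ++-assoc (replicate n' 1) R _ ⟩
        replicate n' 1 ++ R ++ after-v ++ B   ∎)
      where open ≡-Reasoning

    suffix' : ∃ λ R → X' ≡ R ++ replicate n' 1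
    suffix' with R , vB≡ ← suffix-of-++ A (v ++ B) (trans (sym X≡AvB) (proj₂ suffix)) ∣ones∣≤∣vB∣ =
      (A ++ before-v) ++ R , (begin
        A ++ word ++ B                   ≡⟨ cong (λ w → A ++ w ++ B) word-ends ⟩
        A ++ (before-v ++ v) ++ B        ≡⟨ cong (A ++_) (++-assoc before-v v B) ⟩
        A ++ before-v ++ v ++ B          ≡⟨ ++-assoc A before-v _ ⟨
        (A ++ before-v) ++ v ++ B        ≡⟨ cong ((A ++ before-v) ++_) vB≡ ⟩
        (A ++ before-v) ++ R ++ replicate n' 1   ≡⟨ ++-assoc (A ++ before-v) R _ ⟨
        ((A ++ before-v) ++ R) ++ replicate n' 1 ∎)
      where open ≡-Reasoning

    C' : PartialCycle X'
    C' = record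
      { letters    = letters'
      ; prefix     = prefix'
      ; suffix     = suffix'
      ; unique     = Unique-resp-↭ (↭-sym windows-X') (Unique.++⁺ windows-word-unique unique disjoint)
      ; sound      = λ u∈ → [ word-sound , sound ]′ (from-X' u∈)
      ; rot-closed = λ u∈ → [ from-word ∘ word-rot-closed , from-X ∘ rot-closed ]′ (from-X' u∈)
      ; ones∈      = from-X ones∈
      }

    longer : length (windows n X) < length (windows n X')
    longer = begin-strict
      length (windows n X)                             <⟨ s≤s (m≤n+m _ _) ⟩
      d + length (windows n X)                         ≡⟨ cong (_+ _) length-windows-word ⟨
      length (windows n word) + length (windows n X)   ≡⟨ length-++ (windows n word) ⟨
      length (windows n word ++ windows n X)           ≡⟨ ↭-length windows-X' ⟨
      length (windows n X')                            ∎
      where open ≤-Reasoning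

  module _ {X : List ℕ} (C : PartialCycle X) where
    open PartialCycle C

    missing⇒≢ones : ∀ {u} → u ∈ V → u ∉ windows n X → u ≢ replicate (length u) 1
    missing⇒≢ones u∈V u∉X u≡ones =
      u∉X (subst (_∈ windows n X) (sym (trans u≡ones (cong (λ m → replicate m 1) (V-length u∈V)))) ones∈)

    rotation-ending-with-letter≥2 : ∀ {u} → u ∈ V → u ∉ windows n X →
      ∃ λ v → ∃ λ z → v ∷ʳ suc (suc z) ∈ V × v ∷ʳ suc (suc z) ∉ windows n X ×
                      sum (v ∷ʳ suc (suc z)) ≡ sum u
    rotation-ending-with-letter≥2 {u} u∈V u∉X
      with a , z , b , refl ← letter≥2 u (V-letters u∈V) (missing⇒≢ones u∈V u∉X) =
      b ++ a , z , to-r (_∈ V) V-rot u∈V , u∉X ∘ from-r (_∈ windows n X) rot-closed ,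
      sum-↭ (subst₂ _↭_ (sym r≡) (sym u≡) (↭-++-comm b (a ∷ʳ suc (suc z))))
      where
      u≡ : u ≡ (a ∷ʳ suc (suc z)) ++ b
      u≡ = sym (++-assoc a _ b)
      r≡ : (b ++ a) ∷ʳ suc (suc z) ≡ b ++ (a ∷ʳ suc (suc z))
      r≡ = ++-assoc b a _
      to-r : (P : List ℕ → Set) → RotationClosed P → P u → P ((b ++ a) ∷ʳ suc (suc z))
      to-r P closed = subst P (sym r≡) ∘ swap-closed {P = P} closed (a ∷ʳ suc (suc z)) b ∘ subst P u≡
      from-r : (P : List ℕ → Set) → RotationClosed P → P ((b ++ a) ∷ʳ suc (suc z)) → P u
      from-r P closed = subst P (sym u≡) ∘ swap-closed {P = P} closed b (a ∷ʳ suc (suc z)) ∘ subst P r≡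

    -- Rotate a letter ≥ 2 to the end and lower it, until the (n−1)-prefix meets
    -- a window of X; the weight drops at every step.
    junction : ∀ bound {u} → sum u < bound → u ∈ V → u ∉ windows n X → Junction X
    junction (suc bound) {u} sum<bound u∈V u∉X
      with v , z , new∈V , new∉X , sum≡ ← rotation-ending-with-letter≥2 u∈V u∉X
      with v ∷ʳ suc z ∈? windows n X
    ... | yes old∈X = record { ∣v∣≡n' = ∣v∣≡n' ; new∈V = new∈V ; new∉X = new∉X ; old∈X = old∈X }
      where
      ∣v∣≡n' : length v ≡ n'
      ∣v∣≡n' = suc-injective (trans (sym (length-∷ʳ v _)) (V-length new∈V))
    ... | no  old∉X = junction bound smaller (V-decrease new∈V) old∉X
      where
      smaller : sum (v ∷ʳ suc z) < bound
      smaller = <-≤-trans (sum-∷ʳ-< v (suc z)) (≤-pred (subst (_< suc bound) (sym sum≡) sum<bound))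

  missing⇒shorter : ∀ {X u} → PartialCycle X → u ∈ V → u ∉ windows n X → length (windows n X) < length V
  missing⇒shorter {X} {u} C u∈V u∉X = Unique-⊆⇒length≤ {xs = u ∷ windows n X}
    (All.tabulate (λ u'∈X u≡u' → u∉X (subst (_∈ windows n X) (sym u≡u') u'∈X)) ∷ PartialCycle.unique C)
    λ { (here refl) → u∈V ; (there u'∈X) → PartialCycle.sound C u'∈X }

  grow : ∀ fuel {X} → PartialCycle X → length V ≤ length (windows n X) + fuel →
    ∃ λ X' → PartialCycle X' × V ⊆ windows n X'
  grow fuel {X} C bound with ⊆-or-missing (≡-dec _≟_) V (windows n X)
  ... | inj₁ V⊆X = X , C , V⊆X
  grow zero {X} C bound | inj₂ (u , u∈V , u∉X) =
    ⊥-elim (<⇒≱ (missing⇒shorter C u∈V u∉X) (subst (length V ≤_) (+-identityʳ (length (windows n X))) bound))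
  grow (suc fuel) {X} C bound | inj₂ (u , u∈V , u∉X) = continue (splice C (junction C (suc (sum u)) ≤-refl u∈V u∉X))
    where
    continue : (∃ λ X' → PartialCycle X' × length (windows n X) < length (windows n X')) →
      ∃ λ X' → PartialCycle X' × V ⊆ windows n X'
    continue (X' , C' , longer) = grow fuel C' (≤-trans bound
      (subst (_≤ length (windows n X') + fuel) (sym (+-suc (length (windows n X)) fuel)) (+-monoˡ-≤ fuel longer)))

  universal-cycle : ∃ λ X → PartialCycle X × V ⊆ windows n X
  universal-cycle = grow (length V) initial (m≤n+m _ _)

-- Sequences from cyclic words

toList-tabulate : ∀ {B : Set} m (g : ℕ → B) → Vec.toList (Vec.tabulate {n = m} (g ∘ toℕ)) ≡ applyUpTo g m
toList-tabulate zero    g = refl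
toList-tabulate (suc m) g = cong (g 0 ∷_) (toList-tabulate m (g ∘ suc))

module CyclicSequence
  (q n' : ℕ) .{{_ : NonZero q}} (X c R R' : List ℕ)
  (X≡cR : X ≡ c ++ R) (X≡R'c : X ≡ R' ++ c) (∣c∣≡n' : length c ≡ n')
  (letters : All (_< q) X) (unique : Unique (windows (suc n') X)) (nonempty : 0 < length (windows (suc n') X))
  where

  n L : ℕ
  n = suc n'
  L = length R'

  ∣X∣≡L+n' : length X ≡ L + n'
  ∣X∣≡L+n' = trans (cong length X≡R'c) (trans (length-++ R') (cong (L +_) ∣c∣≡n'))

  ∣X∣∸n'≡L : length X ∸ n' ≡ L
  ∣X∣∸n'≡L = trans (cong (_∸ n') ∣X∣≡L+n') (m+n∸n≡m L n')

  length-windows≡L : length (windows n X) ≡ L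
  length-windows≡L = trans (length-windows n' X) ∣X∣∸n'≡L

  instance
    L-nonZero : NonZero L
    L-nonZero = >-nonZero (subst (0 <_) length-windows≡L nonempty)

  wrap-around : ∀ {t} → t < n' → at X (L + t) ≡ at X t
  wrap-around {t} t<n' = begin
    at X (L + t)         ≡⟨ cong (λ w → at w (L + t)) X≡R'c ⟩
    at (R' ++ c) (L + t) ≡⟨ at-++ʳ R' c t ⟩
    at c t               ≡⟨ at-++ˡ c R (subst (t <_) (sym ∣c∣≡n') t<n') ⟨
    at (c ++ R) t        ≡⟨ cong (λ w → at w t) X≡cR ⟨
    at X t               ∎
    where open ≡-Reasoning

  at-+-multiple : ∀ k {t} → t + k * L < L + n' → at X (t + k * L) ≡ at X t
  at-+-multiple zero    {t} _     = cong (at X) (+-identityʳ t)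
  at-+-multiple (suc k) {t} bound = begin
    at X (t + (L + k * L)) ≡⟨ cong (at X) (x+[y+z]≡y+[x+z] t L (k * L)) ⟩
    at X (L + (t + k * L)) ≡⟨ wrap-around t+kL<n' ⟩
    at X (t + k * L)       ≡⟨ at-+-multiple k (<-≤-trans t+kL<n' (m≤n+m n' L)) ⟩
    at X t                 ∎
    where
    open ≡-Reasoning
    x+[y+z]≡y+[x+z] : ∀ x y z → x + (y + z) ≡ y + (x + z)
    x+[y+z]≡y+[x+z] = solve-∀
    t+kL<n' : t + k * L < n'
    t+kL<n' = +-cancelˡ-< L _ _ (subst (_< L + n') (x+[y+z]≡y+[x+z] t L (k * L)) bound)

  at-mod : ∀ {t} → t < L + n' → at X (t % L) ≡ at X t
  at-mod {t} bound = sym (trans (cong (at X) t≡) (at-+-multiple (t / L) (subst (_< L + n') t≡ bound)))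
    where
    t≡ : t ≡ t % L + t / L * L
    t≡ = m≡m%n+[m/n]*n t L

  s : ℕ → Fin q
  s t = at X (t % L) mod q

  toℕ-s : ∀ t → toℕ (s t) ≡ at X (t % L)
  toℕ-s t = trans (toℕ-fromℕ< _)
    (m<n⇒m%n≡m (All-at letters (≤-trans (m%n<n t L) (subst (L ≤_) (sym ∣X∣≡L+n') (m≤m+n L n')))))

  periodic : Periodic L s
  periodic i = cong (λ t → at X t mod q) ([m+n]%n≡m%n i L)

  cyclic-window : ℕ → List ℕ
  cyclic-window j = applyUpTo (λ k → at X (j + k)) n

  windows≡cyclic-windows : windows n X ≡ applyUpTo cyclic-window L
  windows≡cyclic-windows = trans (windows≡applyUpTo n' X)
    (cong (applyUpTo cyclic-window) ∣X∣∸n'≡L)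

  toℕ-window : ∀ i → map toℕ (Vec.toList (window n s i)) ≡ cyclic-window (i % L)
  toℕ-window i = begin
    map toℕ (Vec.toList (window n s i))         ≡⟨ cong (map toℕ) (toList-tabulate n (λ k → s (i + k))) ⟩
    map toℕ (applyUpTo (λ k → s (i + k)) n)     ≡⟨ map-applyUpTo (λ k → s (i + k)) toℕ n ⟩
    applyUpTo (λ k → toℕ (s (i + k))) n         ≡⟨ applyUpTo-cong n (λ k<n → trans (toℕ-s (i + _)) (shift k<n)) ⟩
    cyclic-window (i % L)                       ∎
    where
    open ≡-Reasoning
    shift : ∀ {k} → k < n → at X ((i + k) % L) ≡ at X (i % L + k)
    shift {k} k<n = begin
      at X ((i + k) % L)             ≡⟨ cong (at X) (%-distribˡ-+ i k L) ⟩
      at X ((i % L + k % L) % L)     ≡⟨ cong (λ m → at X ((m + k % L) % L)) (m%n%n≡m%n i L) ⟨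
      at X ((i % L % L + k % L) % L) ≡⟨ cong (at X) (%-distribˡ-+ (i % L) k L) ⟨
      at X ((i % L + k) % L)         ≡⟨ at-mod (+-mono-<-≤ (m%n<n i L) (≤-pred k<n)) ⟩
      at X (i % L + k)               ∎

  toℕ-window-∈ : ∀ i → map toℕ (Vec.toList (window n s i)) ∈ windows n X
  toℕ-window-∈ i = subst₂ _∈_ (sym (toℕ-window i)) (sym windows≡cyclic-windows)
                              (∈-applyUpTo⁺ cyclic-window (m%n<n i L))

  window-injective : ∀ i j → window n s i ≡ window n s j → i ≡ j [mod L ]
  window-injective i j eq = %-equal⇒≡[mod] (Unique-applyUpTo⇒injective cyclic-window L
    (subst Unique windows≡cyclic-windows unique) (m%n<n i L) (m%n<n j L)
    (trans (sym (toℕ-window i)) (trans (cong (map toℕ ∘ Vec.toList) eq) (toℕ-window j))))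

  is-window-sequence : IsNWindowSeq q n L s
  is-window-sequence = periodic , window-injective

-- Light words

sum-replicate-1 : ∀ m → sum (replicate m 1) ≡ m
sum-replicate-1 zero    = refl
sum-replicate-1 (suc m) = cong suc (sum-replicate-1 m)

sum-negTuple-complement : ∀ {q₁} (ys : List (Fin (suc q₁))) → All (λ y → 0 < toℕ y) ys →
  sum (map (toℕ ∘ negℤ) ys) + sum (map toℕ ys) ≡ length ys * suc q₁
sum-negTuple-complement []       []           = refl
sum-negTuple-complement {q₁} (y ∷ ys) (0<y ∷ 0<ys) = begin
  toℕ (negℤ y) + sum (map (toℕ ∘ negℤ) ys) + (toℕ y + sum (map toℕ ys))
    ≡⟨ +-interchange (toℕ (negℤ y)) _ (toℕ y) _ ⟩
  (toℕ (negℤ y) + toℕ y) + (sum (map (toℕ ∘ negℤ) ys) + sum (map toℕ ys))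
    ≡⟨ cong₂ _+_ toℕ-negℤ+toℕ (sum-negTuple-complement ys 0<ys) ⟩
  suc q₁ + length ys * suc q₁ ∎
  where
  open ≡-Reasoning
  y≤q : toℕ y ≤ suc q₁
  y≤q = <⇒≤ (toℕ<n y)
  toℕ-negℤ+toℕ : toℕ (negℤ y) + toℕ y ≡ suc q₁
  toℕ-negℤ+toℕ = trans (cong (_+ toℕ y) (trans (toℕ-fromℕ< _) (m<n⇒m%n≡m (∸-monoʳ-< 0<y y≤q))))
                       (m∸n+n≡m y≤q)

module LightWords (q₁ n' : ℕ) (2≤q₁ : 2 ≤ q₁) where

  open HalfCount q₁ (suc n') public

  n : ℕ
  n = suc n'

  Light : List ℕ → Set
  Light u = length u ≡ n × All (Letter q) u × 2 * sum u < N

  V : List (List ℕ)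
  V = filter below? Z

  V-unique : Unique V
  V-unique = Unique.filter⁺ below? (zeroFreeLists-unique q n)

  ∈V⇒light : ∀ {u} → u ∈ V → Light u
  ∈V⇒light u∈V
    with u∈Z , light    ← ∈-filter⁻ below? u∈V
    with ∣u∣≡n , letters ← ∈-zeroFreeLists⁻ n u∈Z =
    ∣u∣≡n , letters , light

  light⇒∈V : ∀ {u} → Light u → u ∈ V
  light⇒∈V {u} (∣u∣≡n , letters , light) =
    ∈-filter⁺ below? (subst (λ m → u ∈ zeroFreeLists q m) ∣u∣≡n (∈-zeroFreeLists⁺ letters)) light

  light-↭ : ∀ {u w} → u ↭ w → Light u → Light w
  light-↭ u↭w (∣u∣≡n , letters , light) =
    trans (sym (↭-length u↭w)) ∣u∣≡n , All-resp-↭ u↭w letters , subst (λ m → 2 * m < N) (sum-↭ u↭w) light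

  light-decrease : ∀ {v x} → Light (v ∷ʳ suc (suc x)) → Light (v ∷ʳ suc x)
  light-decrease {v} {x} (∣u∣≡n , letters , light) =
    trans (length-∷ʳ v _) (trans (sym (length-∷ʳ v _)) ∣u∣≡n) ,
    All.++⁺ (All.++⁻ˡ v letters) ((s≤s z≤n , <-trans (n<1+n _) (proj₂ (All.head (All.++⁻ʳ v letters)))) ∷ []) ,
    <-trans (*-monoʳ-< 2 (sum-∷ʳ-< v (suc x))) light

  light-ones : Light (replicate n 1)
  light-ones = length-replicate n ,
    All.replicate⁺ n (s≤s z≤n , s≤s (≤-trans (s≤s z≤n) 2≤q₁)) ,
    subst (_< N) (trans (*-comm n 2) (cong (2 *_) (sym (sum-replicate-1 n)))) (*-monoʳ-< n (s≤s 2≤q₁))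

  open CycleJoining q n' V V-unique
    (proj₁ ∘ ∈V⇒light) (proj₁ ∘ proj₂ ∘ ∈V⇒light)
    (λ u∈V → light⇒∈V (light-↭ (↭-sym (rot-↭ _)) (∈V⇒light u∈V)))
    (λ u∈V → light⇒∈V (light-decrease (∈V⇒light u∈V)))
    (light⇒∈V light-ones)
    hiding (n)

  sum-negTuple-reverse : ∀ (w : Vec (Fin q) n) → All (Letter q) (map toℕ (Vec.toList w)) →
    sum (map toℕ (Vec.toList (negTuple (Vec.reverse w)))) + sum (map toℕ (Vec.toList w)) ≡ N
  sum-negTuple-reverse w letters = begin
    sum (map toℕ (Vec.toList (Vec.map negℤ (Vec.reverse w)))) + sum (map toℕ ys)
      ≡⟨ cong (λ zs → sum (map toℕ zs) + sum (map toℕ ys))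
           (trans (Vec.toList-map negℤ (Vec.reverse w)) (cong (map negℤ) (Vec.toList-reverse w))) ⟩
    sum (map toℕ (map negℤ (reverse ys))) + sum (map toℕ ys)
      ≡⟨ cong (λ m → m + sum (map toℕ ys)) (cong sum (map-∘ (reverse ys))) ⟨
    sum (map (toℕ ∘ negℤ) (reverse ys)) + sum (map toℕ ys)
      ≡⟨ cong (λ m → m + sum (map toℕ ys)) (sum-↭ (↭-map⁺ (toℕ ∘ negℤ) (↭-reverse ys))) ⟩
    sum (map (toℕ ∘ negℤ) ys) + sum (map toℕ ys)
      ≡⟨ sum-negTuple-complement ys (All.map⁻ (All.map proj₁ letters)) ⟩
    length ys * q
      ≡⟨ cong (_* q) (Vec.length-toList w) ⟩
    N ∎
    where
    open ≡-Reasoning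
    ys : List (Fin q)
    ys = Vec.toList w

  negative-orientable : ∃ λ s → IsNegOrientable q n #below s
  negative-orientable = s , subst (λ m → IsNegOrientable q n m s) L≡#below (is-window-sequence , no-negated-reversal)
    where
    cycle : ∃ λ X → PartialCycle X × V ⊆ windows n X
    cycle = universal-cycle
    X : List ℕ
    X = proj₁ cycle
    open PartialCycle (proj₁ (proj₂ cycle))
    V⊆X : V ⊆ windows n X
    V⊆X = proj₂ (proj₂ cycle)
    R' : List ℕ
    R' = proj₁ suffix

    open CyclicSequence q n' X (replicate n' 1) (proj₁ prefix) R' (proj₂ prefix) (proj₂ suffix)
      (length-replicate n') (All.map proj₂ letters) unique (∈⇒0<length ones∈)
      using (s; is-window-sequence; toℕ-window-∈; length-windows≡L)

    L≡#below : length R' ≡ #below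
    L≡#below = trans (sym length-windows≡L)
      (≤-antisym (Unique-⊆⇒length≤ unique sound) (Unique-⊆⇒length≤ V-unique V⊆X))

    no-negated-reversal : ∀ i j → window n s i ≢ negTuple (Vec.reverse (window n s j))
    no-negated-reversal i j eq = <-asym (light-sum i) (complement-> {a = weight i} {b = weight j} weight-i+j≡N (light-sum j))
      where
      weight : ℕ → ℕ
      weight i = sum (map toℕ (Vec.toList (window n s i)))
      light : ∀ i → Light (map toℕ (Vec.toList (window n s i)))
      light i = ∈V⇒light (sound (toℕ-window-∈ i))
      light-sum : ∀ i → 2 * weight i < N
      light-sum i = proj₂ (proj₂ (light i))
      weight-i+j≡N : weight i + weight j ≡ N
      weight-i+j≡N = trans (cong (λ w → sum (map toℕ (Vec.toList w)) + weight j) eq)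
                      (sum-negTuple-reverse (window n s j) (proj₁ (proj₂ (light j))))

lemma8 : (q n : ℕ) → 2 < q → 2 ≤ n →
    ((¬ (2 ∣ q)) × (¬ (2 ∣ n)) →
      ∃ λ (s : ℕ → Fin q) → IsNegOrientable q n (((q ∸ 1) ^ n) / 2) s)
    × ((2 ∣ q) ⊎ (2 ∣ n) →
      ∃ λ (s : ℕ → Fin q) →
        IsNegOrientable q n ((((q ∸ 1) ^ n) ∸ k q n ((n * q) / 2)) / 2) s)
lemma8 zero     _        ()         _
lemma8 (suc q₁) zero     _          ()
lemma8 (suc q₁) (suc n') (s≤s 2≤q₁) _ =
    (λ (2∤q , 2∤n) → s , with-period (#below-odd (2∤nq 2∤n 2∤q)))
  , (λ 2∣q⊎2∣n → s , with-period (#below-even (2∣nq 2∣q⊎2∣n)))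
  where
  open LightWords q₁ n' 2≤q₁ using (#below; #below-odd; #below-even; negative-orientable)
  s : ℕ → Fin (suc q₁)
  s = proj₁ negative-orientable
  with-period : ∀ {m} → #below ≡ m → IsNegOrientable (suc q₁) (suc n') m s
  with-period eq = subst (λ m → IsNegOrientable (suc q₁) (suc n') m s) eq (proj₂ negative-orientable)
  2∤nq : ¬ 2 ∣ suc n' → ¬ 2 ∣ suc q₁ → ¬ 2 ∣ suc n' * suc q₁
  2∤nq 2∤n 2∤q = [ 2∤n , 2∤q ]′ ∘ euclidsLemma (suc n') (suc q₁) prime[2]
  2∣nq : 2 ∣ suc q₁ ⊎ 2 ∣ suc n' → 2 ∣ suc n' * suc q₁
  2∣nq = [ flip ∣-trans (n∣m*n (suc n')) , flip ∣-trans (m∣m*n (suc q₁)) ]′
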